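{- Let $\pi\in S_n(1423)$ with $\pi\neq n(n-1)\ldots 1$ and let $\phi(\pi)=(a,b)$. If $\operatorname{Stp}\pi=\emptyset$, then $\operatorname{Stp}\pi^{(1)}\subseteq\{a\}$ and $\operatorname{Stp}\pi^{(2)}=\emptyset$.
   Context: $[x,y]=\{x,\dots,y\}$. $\mathrm{std}$ of a sequence of distinct integers is the permutation order-isomorphic to it. $S_n(1423)$ is the set of permutations in $S_n$ with no subsequence order-isomorphic to $1423$. $\operatorname{Stp}\pi=\{i:\pi_i-1=\pi_{i+1}\}$ (steps). $\operatorname{RLmax}\pi$ is the set of indices $i$ with $\pi_i>\pi_j$ for all $j>i$. For $\pi\ne n(n-1)\ldots1$, $\phi(\pi)=(a,b)$: $b$ is the smallest index with $[b,n]\subseteq\operatorname{RLmax}\pi$; $a=0$ if $\operatorname{RLmax}\pi=[b,n]$, otherwise $a=\max(\operatorname{RLmax}\pi\setminus[b,n])$. $\chi(\pi)=\max\{\pi_i:a<i<b\}$, $\rho(\pi)=|\{i\in\operatorname{RLmax}\pi:i>b,\ \pi_i>\chi(\pi)\}|$, $\pi^{(1)}=\mathrm{std}(\pi_1\ldots\pi_a\pi_b\pi_{b+1}\ldots\pi_{b+\rho(\pi)})$, $\pi^{(2)}=\mathrm{std}(\pi_{a+1}\ldots\pi_b\pi_{b+\rho(\pi)+1}\ldots\pi_n)$. -}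

module Defs where

open import Data.Nat using (ℕ; zero; suc; _+_; _∸_; _≤_; _<_; _⊔_; _<ᵇ_; _≤ᵇ_)
open import Data.Bool using (Bool; _∧_)
open import Data.List using (List; []; _∷_; map; length; filterᵇ; foldr; upTo; _++_)
open import Data.Bool.ListAction using (all)
open import Data.List.Relation.Binary.Sublist.Propositional using (_⊆_)
open import Data.Product using (Σ; _×_; _,_)
open import Relation.Binary.PropositionalEquality using (_≡_)
open import Relation.Nullary using (¬_)

-- [x,y] = {x,...,y} as an increasing list (empty if y < x)
range : ℕ → ℕ → List ℕ
range x y = map (x +_) (upTo (suc y ∸ x))

-- 1-based access π_i (returns 0 out of range; values of permutations are ≥ 1)
get : List ℕ → ℕ → ℕ
get [] _ = 0
get (x ∷ xs) zero = 0
get (x ∷ xs) (suc zero) = x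
get (x ∷ xs) (suc (suc k)) = get xs (suc k)

count : (ℕ → Bool) → List ℕ → ℕ
count p xs = length (filterᵇ p xs)

maxL : List ℕ → ℕ
maxL = foldr _⊔_ 0

-- std: the permutation order-isomorphic to a sequence of distinct integers
-- (each entry replaced by its rank 1 + #{smaller entries})
std : List ℕ → List ℕ
std s = map (λ x → suc (count (λ y → y <ᵇ x) s)) s

Contains : List ℕ → List ℕ → Set
Contains π p = Σ (List ℕ) (λ s → (s ⊆ π) × (std s ≡ p))

Avoids : List ℕ → List ℕ → Set
Avoids π p = ¬ Contains π p

p1423 : List ℕ
p1423 = 1 ∷ 4 ∷ 2 ∷ 3 ∷ []

Stp : List ℕ → ℕ → Set
Stp σ i = (1 ≤ i) × (suc i ≤ length σ) × (get σ i ≡ suc (get σ (suc i)))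

isRLmax : List ℕ → ℕ → Bool
isRLmax π i = (1 ≤ᵇ i) ∧ ((i ≤ᵇ length π) ∧ all (λ j → get π j <ᵇ get π i) (range (suc i) (length π)))

-- first element of a list satisfying p (0 if none)
first : (ℕ → Bool) → List ℕ → ℕ
first p [] = 0
first p (x ∷ xs) with p x
... | Bool.true = x
... | Bool.false = first p xs

phiB : List ℕ → ℕ
phiB π = first (λ b → all (isRLmax π) (range b (length π))) (range 1 (length π))

phiA : List ℕ → ℕ
phiA π = maxL (filterᵇ (isRLmax π) (range 1 (phiB π ∸ 1)))

chi : List ℕ → ℕ
chi π = maxL (map (get π) (range (suc (phiA π)) (phiB π ∸ 1)))

rho : List ℕ → ℕ
rho π = count (λ i → isRLmax π i ∧ (chi π <ᵇ get π i)) (range (suc (phiB π)) (length π))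

pi1 : List ℕ → List ℕ
pi1 π = std (map (get π) (range 1 (phiA π) ++ range (phiB π) (phiB π + rho π)))

pi2 : List ℕ → List ℕ
pi2 π = std (map (get π) (range (suc (phiA π)) (phiB π) ++ range (suc (phiB π + rho π)) (length π)))

module Submission where

open import Defs
open import Data.Nat using (ℕ)
open import Data.List using (List; reverse)
open import Data.List.Relation.Binary.Permutation.Propositional using (_↭_)
open import Data.Product using (_×_)
open import Relation.Binary.PropositionalEquality using (_≡_; _≢_)
open import Relation.Nullary using (¬_)

open import Data.Bool using (Bool; true; false; T; _∧_)
open import Data.Bool.Properties using (T-∧; T-≡; T?)
open import Data.Bool.ListAction using (all)
open import Data.Empty using (⊥; ⊥-elim)
open import Data.List using ([]; _∷_; _++_; map; length; filterᵇ; drop; applyUpTo)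
open import Data.List.Properties using (map-upTo; length-++; length-map; length-filter; filter-accept; filter-reject; filter-none)
open import Data.List.Membership.Propositional using (_∈_; _∉_; find)
open import Data.List.Membership.Propositional.Properties
  using (∈-map⁺; ∈-map⁻; ∈-filter⁺; ∈-filter⁻; ∈-++⁺ˡ; ∈-++⁺ʳ; foldr-selective)
open import Data.List.Relation.Unary.Any using (here; there)
open import Data.List.Relation.Unary.All as All using (All)
open import Data.List.Relation.Unary.All.Properties using (all⁺; all⁻; ¬All⇒Any¬)
open import Data.List.Relation.Unary.AllPairs using (_∷_)
open import Data.List.Relation.Unary.Unique.Propositional using (Unique)
import Data.List.Relation.Unary.Unique.Propositional.Properties as Unique
open import Data.List.Relation.Binary.Sublist.Propositional using (_⊆_; _∷_; _∷ʳ_)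
open import Data.List.Relation.Binary.Sublist.Heterogeneous using (minimum)
open import Data.List.Relation.Binary.Permutation.Propositional using (↭-sym; ↭⇒↭ₛ)
open import Data.List.Relation.Binary.Permutation.Propositional.Properties using (∈-resp-↭; ↭-length)
open import Data.List.Relation.Binary.Permutation.Setoid.Properties using (Unique-resp-↭)
open import Data.Nat
open import Data.Nat.Properties
open import Data.Product using (∃-syntax; _,_; proj₁; proj₂)
open import Data.Sum using (_⊎_; inj₁; inj₂)
open import Function using (_∘_; _⇔_; mk⇔; Equivalence)
open import Relation.Binary.PropositionalEquality using (refl; sym; trans; cong; cong₂; subst; subst₂; setoid; module ≡-Reasoning)
open import Relation.Nullary using (yes; no)
open import Relation.Binary.Definitions using (Tri; tri<; tri≈; tri>)


-- Let (a, b) = φ(π), let χ be the largest value at a position in (a, b) and m its position.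
-- Positions in (a, b) are not right-to-left maxima and π is decreasing on [b, n], so χ < π_b,
-- and π_b < π_a when a > 0.
-- If some p < a had π_p < χ, then π_p π_a π_m π_b would be an occurrence of 1423; hence values
-- before a are ≥ χ, values in (a, b) are ≤ χ, values in [b, b + ρ] are > χ and values after
-- b + ρ are < χ.
-- A step of std σ, for σ a subsequence of π, is a descent between neighbours in σ with no value
-- of σ strictly in between. As π is a permutation without steps, some value π_j lies strictly in
-- between, and the bounds above force j into σ, except at the seam π_a π_b of π⁽¹⁾. At the seam
-- π_b π_(b+ρ+1) of π⁽²⁾ the value χ itself lies in between.

+-<-∸ : ∀ o {m n} → m < n ∸ o → o + m < n
+-<-∸ zero                m< = m<
+-<-∸ (suc o) {n = suc n} m< = s≤s (+-<-∸ o m<)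

<⇒≤∸1 : ∀ {m n} → m < n → m ≤ n ∸ 1
<⇒≤∸1 (s≤s m≤n) = m≤n

≤∸1⇒< : ∀ {m n} → 1 ≤ n → m ≤ n ∸ 1 → m < n
≤∸1⇒< {n = suc n} _ m≤n = s≤s m≤n

∸1<⇒≤ : ∀ {m n} → 1 ≤ n → n ∸ 1 < m → n ≤ m
∸1<⇒≤ {n = suc n} _ n<m = n<m

suc≡∸⇒≡+ : ∀ x {y t} → suc t ≡ suc y ∸ x → y ≡ x + t
suc≡∸⇒≡+ zero                e = suc-injective (sym e)
suc≡∸⇒≡+ (suc x) {suc y}     e = cong suc (suc≡∸⇒≡+ x e)
suc≡∸⇒≡+ (suc x) {zero}  {t} e = ⊥-elim (1+n≢0 (trans e (0∸n≡0 x)))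

get-∈ : ∀ xs {i} → 1 ≤ i → i ≤ length xs → get xs i ∈ xs
get-∈ (x ∷ xs) {suc zero}    _ _        = here refl
get-∈ (x ∷ xs) {suc (suc i)} _ (s≤s le) = there (get-∈ xs (s≤s z≤n) le)

∈⇒get : ∀ {x} xs → x ∈ xs → ∃[ i ] 1 ≤ i × i ≤ length xs × get xs i ≡ x
∈⇒get (y ∷ ys) (here refl) = 1 , s≤s z≤n , s≤s z≤n , refl
∈⇒get (y ∷ ys) (there x∈ys) with ∈⇒get ys x∈ys
... | suc i , _ , i≤ , eq = suc (suc i) , s≤s z≤n , s≤s i≤ , eq

get-map : ∀ (f : ℕ → ℕ) xs {i} → 1 ≤ i → i ≤ length xs → get (map f xs) i ≡ f (get xs i)
get-map f (x ∷ xs) {suc zero}    _ _        = refl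
get-map f (x ∷ xs) {suc (suc i)} _ (s≤s le) = get-map f xs (s≤s z≤n) le

get-++ˡ : ∀ xs ys {i} → 1 ≤ i → i ≤ length xs → get (xs ++ ys) i ≡ get xs i
get-++ˡ (x ∷ xs) ys {suc zero}    _ _        = refl
get-++ˡ (x ∷ xs) ys {suc (suc i)} _ (s≤s le) = get-++ˡ xs ys (s≤s z≤n) le

get-++ʳ : ∀ xs ys i → get (xs ++ ys) (suc (length xs + i)) ≡ get ys (suc i)
get-++ʳ []       ys i = refl
get-++ʳ (x ∷ xs) ys i = get-++ʳ xs ys i

get-injective : ∀ {xs} → Unique xs → ∀ {i j} → 1 ≤ i → i ≤ length xs → 1 ≤ j → j ≤ length xs →
                get xs i ≡ get xs j → i ≡ j
get-injective {x ∷ xs} _ {suc zero} {suc zero} _ _ _ _ _ = refl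
get-injective {x ∷ xs} (x∉xs ∷ _) {suc zero} {suc (suc j)} _ _ _ (s≤s j≤) eq =
  ⊥-elim (All.lookup x∉xs (get-∈ xs (s≤s z≤n) j≤) eq)
get-injective {x ∷ xs} (x∉xs ∷ _) {suc (suc i)} {suc zero} _ (s≤s i≤) _ _ eq =
  ⊥-elim (All.lookup x∉xs (get-∈ xs (s≤s z≤n) i≤) (sym eq))
get-injective {x ∷ xs} (_ ∷ u) {suc (suc i)} {suc (suc j)} _ (s≤s i≤) _ (s≤s j≤) eq =
  cong suc (get-injective u (s≤s z≤n) i≤ (s≤s z≤n) j≤ eq)

get-∷-⊆-drop : ∀ xs {d i s} → d < i → i ≤ length xs → s ⊆ drop i xs → get xs i ∷ s ⊆ drop d xs
get-∷-⊆-drop (x ∷ xs) {zero}  {suc zero}    _ _ s⊆ = refl ∷ s⊆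
get-∷-⊆-drop (x ∷ xs) {zero}  {suc (suc i)} _ (s≤s i≤) s⊆ = x ∷ʳ get-∷-⊆-drop xs (s≤s z≤n) i≤ s⊆
get-∷-⊆-drop (x ∷ xs) {suc d} {suc (suc i)} (s≤s d<) (s≤s i≤) s⊆ = get-∷-⊆-drop xs d< i≤ s⊆

singleton-get : ∀ xs → length xs ≡ 1 → xs ≡ get xs 1 ∷ []
singleton-get (x ∷ []) _ = refl

nonempty-length : ∀ {xs : List ℕ} → xs ≢ [] → 1 ≤ length xs
nonempty-length {[]}    xs≢[] = ⊥-elim (xs≢[] refl)
nonempty-length {_ ∷ _} _     = s≤s z≤n

interval : ℕ → ℕ → List ℕ
interval x zero    = []
interval x (suc k) = x ∷ interval (suc x) k

applyUpTo-interval : ∀ {f} x k → (∀ i → f i ≡ x + i) → applyUpTo f k ≡ interval x k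
applyUpTo-interval x zero    _  = refl
applyUpTo-interval x (suc k) f≗ =
  cong₂ _∷_ (trans (f≗ 0) (+-identityʳ x)) (applyUpTo-interval (suc x) k (λ i → trans (f≗ (suc i)) (+-suc x i)))

range≡interval : ∀ x y → range x y ≡ interval x (suc y ∸ x)
range≡interval x y = trans (map-upTo (x +_) _) (applyUpTo-interval x _ (λ _ → refl))

length-interval : ∀ x k → length (interval x k) ≡ k
length-interval x zero    = refl
length-interval x (suc k) = cong suc (length-interval (suc x) k)

length-range : ∀ x y → length (range x y) ≡ suc y ∸ x
length-range x y = trans (cong length (range≡interval x y)) (length-interval x _)

get-interval : ∀ x {k t} → t < k → get (interval x k) (suc t) ≡ x + t
get-interval x {suc k} {zero}  _        = sym (+-identityʳ x)
get-interval x {suc k} {suc t} (s≤s t<) = trans (get-interval (suc x) t<) (sym (+-suc x t))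

∈-interval⁺ : ∀ x {k t} → t < k → x + t ∈ interval x k
∈-interval⁺ x {suc k} {zero}  _        = here (+-identityʳ x)
∈-interval⁺ x {suc k} {suc t} (s≤s t<) = there (subst (_∈ interval (suc x) k) (sym (+-suc x t)) (∈-interval⁺ (suc x) t<))

∈-interval⁻ : ∀ x {k j} → j ∈ interval x k → ∃[ t ] t < k × j ≡ x + t
∈-interval⁻ x {suc k} (here refl) = 0 , z<s , sym (+-identityʳ x)
∈-interval⁻ x {suc k} (there j∈) with ∈-interval⁻ (suc x) j∈
... | t , t< , refl = suc t , s≤s t< , sym (+-suc x t)

interval-lower : ∀ x {k j} → j ∈ interval x k → x ≤ j
interval-lower x j∈ with ∈-interval⁻ x j∈
... | t , _ , refl = m≤m+n x t

∈-range⁺ : ∀ {x y j} → x ≤ j → j ≤ y → j ∈ range x y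
∈-range⁺ {x} {y} {j} x≤j j≤y rewrite range≡interval x y =
  subst (_∈ _) (m+[n∸m]≡n x≤j) (∈-interval⁺ x (∸-monoˡ-< (s≤s j≤y) x≤j))

∈-range⁻ : ∀ {x y j} → j ∈ range x y → x ≤ j × j ≤ y
∈-range⁻ {x} {y} j∈ rewrite range≡interval x y with ∈-interval⁻ x j∈
... | t , t< , refl = m≤m+n x t , s≤s⁻¹ (+-<-∸ x t<)

unique-range : ∀ x y → Unique (range x y)
unique-range x y = Unique.map⁺ (+-cancelˡ-≡ x _ _) (Unique.upTo⁺ (suc y ∸ x))

get-++-interval : ∀ x {k t} J → t < k → get (interval x k ++ J) (suc t) ≡ x + t
get-++-interval x {k} J t<k = trans (get-++ˡ (interval x k) J (s≤s z≤n) (subst (_ <_) (sym (length-interval x k)) t<k))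
                                    (get-interval x t<k)

get-interval-++ : ∀ I z {l t} → t < l → get (I ++ interval z l) (suc (length I + t)) ≡ z + t
get-interval-++ I z {l} t<l = trans (get-++ʳ I (interval z l) _) (get-interval z t<l)

data Consecutive (x y z w i : ℕ) : ℕ → ℕ → Set where
  left     : ∀ {u} → x ≤ u → suc u ≤ y → Consecutive x y z w i u (suc u)
  junction : i ≡ suc y ∸ x → z ≤ w → Consecutive x y z w i y z
  right    : ∀ {u} → z ≤ u → suc u ≤ w → Consecutive x y z w i u (suc u)

consecutive-ranges : ∀ x y z w {i} → 1 ≤ i → suc i ≤ length (range x y ++ range z w) →
                     let L = range x y ++ range z w in Consecutive x y z w i (get L i) (get L (suc i))
consecutive-ranges x y z w {suc t} _ i<len rewrite range≡interval x y | range≡interval z w =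
  classify (<-cmp (suc t) k)
  where
  k l : ℕ
  k = suc y ∸ x
  l = suc w ∸ z
  I J : List ℕ
  I = interval x k
  J = interval z l
  |I|≡k : length I ≡ k
  |I|≡k = length-interval x k
  t+2≤k+l : suc (suc t) ≤ k + l
  t+2≤k+l = subst (suc (suc t) ≤_) (trans (length-++ I) (cong₂ _+_ |I|≡k (length-interval z l))) i<len
  classify : Tri (suc t < k) (suc t ≡ k) (k < suc t) →
             Consecutive x y z w (suc t) (get (I ++ J) (suc t)) (get (I ++ J) (suc (suc t)))
  classify (tri< t+1<k _ _) =
    subst₂ (Consecutive x y z w (suc t)) (sym (get-++-interval x J (<-trans (n<1+n t) t+1<k)))
           (sym (trans (get-++-interval x J t+1<k) (+-suc x t)))
           (left (m≤m+n x t) (subst (_≤ y) (+-suc x t) (s≤s⁻¹ (+-<-∸ x t+1<k))))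
  classify (tri≈ _ t+1≡k _) =
    subst₂ (Consecutive x y z w (suc t))
           (trans (suc≡∸⇒≡+ x t+1≡k) (sym (get-++-interval x J (subst (t <_) t+1≡k (n<1+n t)))))
           (sym (trans (cong (λ m → get (I ++ J) (suc m)) t+1≡|I|+0) (trans (get-interval-++ I z 0<l) (+-identityʳ z))))
           (junction t+1≡k (s≤s⁻¹ (subst (_< suc w) (+-identityʳ z) (+-<-∸ z 0<l))))
    where
    t+1≡|I|+0 : suc t ≡ length I + 0
    t+1≡|I|+0 = trans t+1≡k (sym (trans (+-identityʳ (length I)) |I|≡k))
    0<l : 0 < l
    0<l = +-cancelˡ-< (suc t) 0 l (subst (λ m → suc m ≤ suc t + l) (sym (+-identityʳ (suc t)))
                                    (subst (λ m → suc (suc t) ≤ m + l) (sym t+1≡k) t+2≤k+l))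
  classify (tri> _ _ k<t+1) =
    subst₂ (Consecutive x y z w (suc t))
           (sym (trans (cong (λ m → get (I ++ J) (suc m)) t≡|I|+t′) (get-interval-++ I z (<-trans (n<1+n t′) t′+1<l))))
           (sym (trans (cong (λ m → get (I ++ J) (suc m)) (trans (cong suc t≡|I|+t′) (sym (+-suc (length I) t′))))
                       (trans (get-interval-++ I z t′+1<l) (+-suc z t′))))
           (right (m≤m+n z t′) (subst (_≤ w) (+-suc z t′) (s≤s⁻¹ (+-<-∸ z t′+1<l))))
    where
    open ≡-Reasoning
    t′ : ℕ
    t′ = t ∸ k
    t≡|I|+t′ : t ≡ length I + t′
    t≡|I|+t′ = sym (trans (cong (_+ t′) |I|≡k) (m+[n∸m]≡n (s≤s⁻¹ k<t+1)))
    t′+1<l : suc t′ < l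
    t′+1<l = +-cancelˡ-< k (suc t′) l (subst (_≤ k + l) (begin
               suc (suc t)              ≡⟨ cong (suc ∘ suc) (trans t≡|I|+t′ (cong (_+ t′) |I|≡k)) ⟩
               suc (suc (k + t′))       ≡⟨ sym (cong suc (+-suc k t′)) ⟩
               suc (k + suc t′)         ∎) t+2≤k+l)

first-interval : ∀ (p : ℕ → Bool) x k {j} → j ∈ interval x k → T (p j) →
                 let f = first p (interval x k) in
                 f ∈ interval x k × f ≤ j × T (p f) × (∀ {i} → i ∈ interval x k → i < f → ¬ T (p i))
first-interval p x (suc k) {j} j∈ pj with p x in px
... | true  = here refl , interval-lower x j∈ , subst T (sym px) _ ,
              λ i∈ i<x → ⊥-elim (<⇒≱ i<x (interval-lower x i∈))
... | false with j∈
...   | here refl = ⊥-elim (subst T px pj)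
...   | there j∈′ with first-interval p (suc x) k j∈′ pj
...     | f∈ , f≤j , pf , least = there f∈ , f≤j , pf , least′
  where
  least′ : ∀ {i} → i ∈ interval x (suc k) → i < first p (interval (suc x) k) → ¬ T (p i)
  least′ (here refl) _ = subst T px
  least′ (there i∈) i<f = least i∈ i<f

first-range : ∀ (p : ℕ → Bool) x y {j} → j ∈ range x y → T (p j) →
              let f = first p (range x y) in
              f ∈ range x y × f ≤ j × T (p f) × (∀ {i} → i ∈ range x y → i < f → ¬ T (p i))
first-range p x y rewrite range≡interval x y = first-interval p x (suc y ∸ x)

count-interval : ∀ (q : ℕ → Bool) x k →
                 (∀ {i j} → i ∈ interval x k → j ∈ interval x k → i ≤ j → T (q j) → T (q i)) →
                 ∀ {j} → j ∈ interval x k → T (q j) ⇔ j < x + count q (interval x k)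
count-interval q x (suc k) closed {j} j∈ with q x in qx
... | true with j∈
...   | here refl = mk⇔ (λ _ → m<m+n x z<s) (λ _ → subst T (sym qx) _)
...   | there j∈′ = subst (λ c → T (q j) ⇔ j < c) (sym (+-suc x (count q (interval (suc x) k))))
                      (count-interval q (suc x) k (λ i∈ j∈ → closed (there i∈) (there j∈)) j∈′)
count-interval q x (suc k) closed {j} j∈ | false =
  mk⇔ (λ qj → ⊥-elim (subst T qx (closed (here refl) j∈ (interval-lower x j∈) qj)))
      (λ j< → ⊥-elim (<⇒≱ j< (subst (_≤ j) (sym x+c≡x) (interval-lower x j∈))))
  where
  x+c≡x : x + count q (interval (suc x) k) ≡ x
  x+c≡x = trans (cong (λ xs → x + length xs) (filter-none (T? ∘ q) (All.tabulate
            (λ i∈ qi → subst T qx (closed (here refl) (there i∈) (<⇒≤ (interval-lower (suc x) i∈)) qi)))))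
          (+-identityʳ x)

count-range : ∀ (q : ℕ → Bool) x y →
              (∀ {i j} → i ∈ range x y → j ∈ range x y → i ≤ j → T (q j) → T (q i)) →
              ∀ {j} → j ∈ range x y → T (q j) ⇔ j < x + count q (range x y)
count-range q x y rewrite range≡interval x y = count-interval q x (suc y ∸ x)

count≤length : ∀ (q : ℕ → Bool) xs → count q xs ≤ length xs
count≤length q = length-filter (T? ∘ q)

count-mono : ∀ {p q : ℕ → Bool} xs → (∀ {y} → T (p y) → T (q y)) → count p xs ≤ count q xs
count-mono [] _ = z≤n
count-mono {p} {q} (x ∷ xs) p⇒q with p x in px | q x in qx
... | true  | true  = s≤s (count-mono xs p⇒q)
... | false | true  = m≤n⇒m≤1+n (count-mono xs p⇒q)
... | false | false = count-mono xs p⇒q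
... | true  | false = ⊥-elim (subst T qx (p⇒q (subst T (sym px) _)))

count-mono-< : ∀ {p q : ℕ → Bool} {xs u} → (∀ {y} → T (p y) → T (q y)) →
               u ∈ xs → ¬ T (p u) → T (q u) → count p xs < count q xs
count-mono-< {p} {q} {u ∷ xs} p⇒q (here refl) ¬pu qu
  rewrite filter-reject (T? ∘ p) {xs = xs} ¬pu | filter-accept (T? ∘ q) {xs = xs} qu = s≤s (count-mono xs p⇒q)
count-mono-< {p} {q} {x ∷ xs} p⇒q (there u∈) ¬pu qu with p x in px | q x in qx
... | true  | true  = s≤s (count-mono-< p⇒q u∈ ¬pu qu)
... | false | true  = m≤n⇒m≤1+n (count-mono-< p⇒q u∈ ¬pu qu)
... | false | false = count-mono-< p⇒q u∈ ¬pu qu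
... | true  | false = ⊥-elim (subst T qx (p⇒q (subst T (sym px) _)))

maxL-upper : ∀ {x} xs → x ∈ xs → x ≤ maxL xs
maxL-upper (y ∷ ys) (here refl) = m≤m⊔n y (maxL ys)
maxL-upper (y ∷ ys) (there x∈)  = ≤-trans (maxL-upper ys x∈) (m≤n⊔m y (maxL ys))

maxL-selective : ∀ xs → maxL xs ≡ 0 ⊎ maxL xs ∈ xs
maxL-selective = foldr-selective ⊔-sel 0

-- Standardisation

rank : List ℕ → ℕ → ℕ
rank s x = count (λ y → y <ᵇ x) s

rank-mono : ∀ s {x y} → x ≤ y → rank s x ≤ rank s y
rank-mono s x≤y = count-mono s (λ {z} z<x → <⇒<ᵇ (<-≤-trans (<ᵇ⇒< z _ z<x) x≤y))

rank-mono-< : ∀ s {x y u} → u ∈ s → x ≤ u → u < y → rank s x < rank s y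
rank-mono-< s {x} {y} {u} u∈ x≤u u<y =
  count-mono-< (λ {z} z<x → <⇒<ᵇ (<-trans (<ᵇ⇒< z x z<x) (≤-<-trans x≤u u<y)))
               u∈ (λ u<x → <⇒≱ (<ᵇ⇒< u x u<x) x≤u) (<⇒<ᵇ u<y)

std-step : ∀ s {i} → Stp (std s) i →
           1 ≤ i × suc i ≤ length s × get s (suc i) < get s i ×
           (∀ {w} → w ∈ s → get s (suc i) < w → w < get s i → ⊥)
std-step s {i} (1≤i , i<len , step) = 1≤i , i<len′ , descent , gapless
  where
  open ≡-Reasoning
  i<len′ : suc i ≤ length s
  i<len′ = subst (suc i ≤_) (length-map _ s) i<len
  rank-step : rank s (get s i) ≡ suc (rank s (get s (suc i)))
  rank-step = suc-injective (begin
    suc (rank s (get s i))        ≡⟨ get-map (suc ∘ rank s) s 1≤i (≤-trans (n≤1+n i) i<len′) ⟨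
    get (std s) i                 ≡⟨ step ⟩
    suc (get (std s) (suc i))     ≡⟨ cong suc (get-map (suc ∘ rank s) s (s≤s z≤n) i<len′) ⟩
    suc (suc (rank s (get s (suc i)))) ∎)
  descent : get s (suc i) < get s i
  descent = ≰⇒> λ u≤v → 1+n≰n (subst (_≤ rank s (get s (suc i))) rank-step (rank-mono s u≤v))
  gapless : ∀ {w} → w ∈ s → get s (suc i) < w → w < get s i → ⊥
  gapless {w} w∈ v<w w<u = <⇒≱ (rank-mono-< s w∈ ≤-refl w<u)
    (subst (_≤ rank s w) (sym rank-step) (rank-mono-< s (get-∈ s (s≤s z≤n) i<len′) ≤-refl v<w))

GaplessDescent : (ℕ → ℕ) → List ℕ → ℕ → ℕ → Set
GaplessDescent f L u v = f v < f u × (∀ {j} → j ∈ L → f v < f j → f j < f u → ⊥)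

std-map-step : ∀ (f : ℕ → ℕ) L {i} → Stp (std (map f L)) i →
               1 ≤ i × suc i ≤ length L × GaplessDescent f L (get L i) (get L (suc i))
std-map-step f L {i} st with std-step (map f L) st
... | 1≤i , i<len , descent , gapless =
  1≤i , i<len′ , subst₂ _<_ (get-map f L (s≤s z≤n) i<len′) (get-map f L 1≤i (≤-trans (n≤1+n i) i<len′)) descent ,
  λ j∈ v<j j<u → gapless (∈-map⁺ f j∈) (subst (_< f _) (sym (get-map f L (s≤s z≤n) i<len′)) v<j)
                                      (subst (f _ <_) (sym (get-map f L 1≤i (≤-trans (n≤1+n i) i<len′))) j<u)
  where
  i<len′ : suc i ≤ length L
  i<len′ = subst (suc i ≤_) (length-map f L) i<len

<ᵇ-true : ∀ {m n} → m < n → (m <ᵇ n) ≡ true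
<ᵇ-true m<n = Equivalence.to T-≡ (<⇒<ᵇ m<n)

<ᵇ-false : ∀ {m n} → n ≤ m → (m <ᵇ n) ≡ false
<ᵇ-false {m} {n} n≤m with m <ᵇ n in m<ᵇn
... | false = refl
... | true  = ⊥-elim (<⇒≱ (<ᵇ⇒< m n (subst T (sym m<ᵇn) _)) n≤m)

std-1423 : ∀ {a b c d} → a < c → c < d → d < b → std (a ∷ b ∷ c ∷ d ∷ []) ≡ p1423
std-1423 {a} {b} {c} {d} a<c c<d d<b = go (<-trans a<c c<d) (<-trans c<d d<b) (<-trans (<-trans a<c c<d) d<b)
  where
  go : a < d → c < b → a < b → std (a ∷ b ∷ c ∷ d ∷ []) ≡ p1423
  go a<d c<b a<b
    rewrite <ᵇ-false (≤-refl {a}) | <ᵇ-false {b} (<⇒≤ a<b) | <ᵇ-false {c} (<⇒≤ a<c) | <ᵇ-false {d} (<⇒≤ a<d)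
          | <ᵇ-true a<b | <ᵇ-false (≤-refl {b}) | <ᵇ-true c<b | <ᵇ-true d<b
          | <ᵇ-true a<c | <ᵇ-false {b} (<⇒≤ c<b) | <ᵇ-false (≤-refl {c}) | <ᵇ-false {d} (<⇒≤ c<d)
          | <ᵇ-true a<d | <ᵇ-false {b} (<⇒≤ d<b) | <ᵇ-true c<d | <ᵇ-false (≤-refl {d}) = refl

contains-1423-at : ∀ xs {i₁ i₂ i₃ i₄} → 1 ≤ i₁ → i₁ < i₂ → i₂ < i₃ → i₃ < i₄ → i₄ ≤ length xs →
                   get xs i₁ < get xs i₃ → get xs i₃ < get xs i₄ → get xs i₄ < get xs i₂ → Contains xs p1423
contains-1423-at xs {i₁} {i₂} {i₃} {i₄} 1≤i₁ i₁<i₂ i₂<i₃ i₃<i₄ i₄≤ v₁<v₃ v₃<v₄ v₄<v₂ =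
  _ , get-∷-⊆-drop xs 1≤i₁ i₁≤ (get-∷-⊆-drop xs i₁<i₂ i₂≤ (get-∷-⊆-drop xs i₂<i₃ i₃≤
        (get-∷-⊆-drop xs i₃<i₄ i₄≤ (minimum _)))) ,
  std-1423 v₁<v₃ v₃<v₄ v₄<v₂
  where
  i₃≤ : i₃ ≤ length xs
  i₃≤ = ≤-trans (<⇒≤ i₃<i₄) i₄≤
  i₂≤ : i₂ ≤ length xs
  i₂≤ = ≤-trans (<⇒≤ i₂<i₃) i₃≤
  i₁≤ : i₁ ≤ length xs
  i₁≤ = ≤-trans (<⇒≤ i₁<i₂) i₂≤

-- Permutations of [1, n]

module Permutation (π : List ℕ) (π↭ : π ↭ range 1 (length π)) where

  n : ℕ
  n = length π

  π[_] : ℕ → ℕ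
  π[ i ] = get π i

  value-bounds : ∀ {i} → 1 ≤ i → i ≤ n → 1 ≤ π[ i ] × π[ i ] ≤ n
  value-bounds 1≤i i≤n = ∈-range⁻ (∈-resp-↭ π↭ (get-∈ π 1≤i i≤n))

  value-onto : ∀ {v} → 1 ≤ v → v ≤ n → ∃[ j ] 1 ≤ j × j ≤ n × π[ j ] ≡ v
  value-onto 1≤v v≤n = ∈⇒get π (∈-resp-↭ (↭-sym π↭) (∈-range⁺ 1≤v v≤n))

  π-injective : ∀ {i j} → 1 ≤ i → i ≤ n → 1 ≤ j → j ≤ n → π[ i ] ≡ π[ j ] → i ≡ j
  π-injective = get-injective (Unique-resp-↭ (setoid ℕ) (↭⇒↭ₛ (↭-sym π↭)) (unique-range 1 n))

  π-≤∧≢⇒< : ∀ {i j} → 1 ≤ i → i ≤ n → 1 ≤ j → j ≤ n → i ≢ j → π[ i ] ≤ π[ j ] → π[ i ] < π[ j ]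
  π-≤∧≢⇒< 1≤i i≤n 1≤j j≤n i≢j πi≤πj = ≤∧≢⇒< πi≤πj (i≢j ∘ π-injective 1≤i i≤n 1≤j j≤n)

  descent-gap : (∀ i → ¬ Stp π i) → ∀ {i} → 1 ≤ i → suc i ≤ n → π[ suc i ] < π[ i ] →
                ∃[ j ] 1 ≤ j × j ≤ n × π[ suc i ] < π[ j ] × π[ j ] < π[ i ]
  descent-gap no-steps {i} 1≤i i<n descent with π[ i ] in πi≡ | descent
  ... | suc v | s≤s πi+1≤v with m≤n⇒m<n∨m≡n πi+1≤v
  ...   | inj₂ step = ⊥-elim (no-steps i (1≤i , i<n , trans πi≡ (cong suc (sym step))))
  ...   | inj₁ πi+1<v with value-onto (≤-trans (s≤s z≤n) πi+1<v) v≤n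
    where
    v≤n : v ≤ n
    v≤n = ≤-trans (n≤1+n v) (subst (_≤ n) πi≡ (proj₂ (value-bounds 1≤i (≤-trans (n≤1+n i) i<n))))
  ...     | j , 1≤j , j≤n , πj≡v =
    j , 1≤j , j≤n , subst (π[ suc i ] <_) (sym πj≡v) πi+1<v , subst (_< suc v) (sym πj≡v) (n<1+n v)

  RLmax : ℕ → Set
  RLmax i = T (isRLmax π i)

  RLmax⁻ : ∀ {i} → RLmax i → 1 ≤ i × i ≤ n × (∀ {j} → i < j → j ≤ n → π[ j ] < π[ i ])
  RLmax⁻ {i} r with Equivalence.to T-∧ r
  ... | 1≤ᵇi , r′ with Equivalence.to T-∧ r′
  ...   | i≤ᵇn , dominates =
    ≤ᵇ⇒≤ 1 i 1≤ᵇi , ≤ᵇ⇒≤ i n i≤ᵇn ,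
    λ i<j j≤n → <ᵇ⇒< _ _ (All.lookup (all⁺ _ _ dominates) (∈-range⁺ i<j j≤n))

  RLmax⁺ : ∀ {i} → 1 ≤ i → i ≤ n → (∀ {j} → i < j → j ≤ n → π[ j ] < π[ i ]) → RLmax i
  RLmax⁺ 1≤i i≤n dominates = Equivalence.from T-∧ (≤⇒≤ᵇ 1≤i , Equivalence.from T-∧ (≤⇒≤ᵇ i≤n ,
    all⁻ _ (All.tabulate λ j∈ → <⇒<ᵇ (dominates (proj₁ (∈-range⁻ j∈)) (proj₂ (∈-range⁻ j∈))))))

  ¬RLmax⇒ : ∀ {i} → 1 ≤ i → i ≤ n → ¬ RLmax i → ∃[ j ] i < j × j ≤ n × π[ i ] < π[ j ]
  ¬RLmax⇒ {i} 1≤i i≤n ¬r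
    with find (¬All⇒Any¬ (T? ∘ λ j → π[ j ] <ᵇ π[ i ]) _ (¬r ∘ RLmax⁺ 1≤i i≤n ∘ dominates))
    where
    dominates : All (λ j → T (π[ j ] <ᵇ π[ i ])) (range (suc i) n) → ∀ {j} → i < j → j ≤ n → π[ j ] < π[ i ]
    dominates all i<j j≤n = <ᵇ⇒< _ _ (All.lookup all (∈-range⁺ i<j j≤n))
  ... | j , j∈ , ¬πj<πi with ∈-range⁻ j∈
  ...   | i<j , j≤n =
    j , i<j , j≤n , π-≤∧≢⇒< 1≤i i≤n (≤-trans 1≤i (<⇒≤ i<j)) j≤n (<⇒≢ i<j) (≮⇒≥ (¬πj<πi ∘ <⇒<ᵇ))

-- The decomposition π ↦ (π⁽¹⁾, π⁽²⁾)

module Decomposition (π : List ℕ) (π↭ : π ↭ range 1 (length π)) (avoids : Avoids π p1423)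
                     (not-decreasing : π ≢ reverse (range 1 (length π))) (no-steps : ∀ i → ¬ Stp π i) where

  open Permutation π π↭

  1≤n : 1 ≤ n
  1≤n = nonempty-length λ π≡[] → not-decreasing (subst (λ xs → xs ≡ reverse (range 1 (length xs))) (sym π≡[]) refl)

  RLsuffix : ℕ → Bool
  RLsuffix c = all (isRLmax π) (range c n)

  RLsuffix-n : T (RLsuffix n)
  RLsuffix-n = all⁻ (isRLmax π) (All.tabulate {xs = range n n} λ j∈ →
    subst RLmax (≤-antisym (proj₁ (∈-range⁻ j∈)) (proj₂ (∈-range⁻ j∈)))
          (RLmax⁺ 1≤n ≤-refl (λ n<j j≤n → ⊥-elim (<⇒≱ n<j j≤n))))

  b : ℕ
  b = phiB π

  b-first : b ∈ range 1 n × b ≤ n × T (RLsuffix b) × (∀ {i} → i ∈ range 1 n → i < b → ¬ T (RLsuffix i))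
  b-first = first-range RLsuffix 1 n (∈-range⁺ 1≤n ≤-refl) RLsuffix-n

  1≤b : 1 ≤ b
  1≤b = proj₁ (∈-range⁻ (proj₁ b-first))

  b≤n : b ≤ n
  b≤n = proj₁ (proj₂ b-first)

  suffix-RLmax : ∀ {j} → b ≤ j → j ≤ n → RLmax j
  suffix-RLmax b≤j j≤n = All.lookup (all⁺ _ _ (proj₁ (proj₂ (proj₂ b-first)))) (∈-range⁺ b≤j j≤n)

  suffix-decreasing : ∀ {i j} → b ≤ i → i < j → j ≤ n → π[ j ] < π[ i ]
  suffix-decreasing b≤i i<j j≤n = proj₂ (proj₂ (RLmax⁻ (suffix-RLmax b≤i (≤-trans (<⇒≤ i<j) j≤n)))) i<j j≤n

  suffix-nonincreasing : ∀ {i j} → b ≤ i → i ≤ j → j ≤ n → π[ j ] ≤ π[ i ]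
  suffix-nonincreasing b≤i i≤j j≤n with m≤n⇒m<n∨m≡n i≤j
  ... | inj₁ i<j  = <⇒≤ (suffix-decreasing b≤i i<j j≤n)
  ... | inj₂ refl = ≤-refl

  -- b = 1 would make π decreasing.
  2≤b : 2 ≤ b
  2≤b with b in b≡
  ... | zero        = ⊥-elim (1+n≰n (subst (1 ≤_) b≡ 1≤b))
  ... | suc (suc _) = s≤s (s≤s z≤n)
  ... | suc zero with n ≟ 1
  ...   | yes n≡1 = ⊥-elim (not-decreasing (begin
            π                            ≡⟨ singleton-get π n≡1 ⟩
            π[ 1 ] ∷ []                  ≡⟨ cong (_∷ []) π[1]≡1 ⟩
            reverse (range 1 1)          ≡⟨ cong (reverse ∘ range 1) n≡1 ⟨
            reverse (range 1 n)          ∎))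
    where
    open ≡-Reasoning
    π[1]≡1 : π[ 1 ] ≡ 1
    π[1]≡1 = ≤-antisym (subst (π[ 1 ] ≤_) n≡1 (proj₂ (value-bounds ≤-refl 1≤n))) (proj₁ (value-bounds ≤-refl 1≤n))
  ...   | no n≢1 with descent-gap no-steps ≤-refl 2≤n (suffix-decreasing 1≤1 ≤-refl 2≤n)
    where
    1≤1 : b ≤ 1
    1≤1 = ≤-reflexive b≡
    2≤n : 2 ≤ n
    2≤n = ≤∧≢⇒< 1≤n (n≢1 ∘ sym)
  ...     | suc zero          , _ , _ , _ , π[1]<π[1] = ⊥-elim (<-irrefl refl π[1]<π[1])
  ...     | suc (suc zero)    , _ , _ , π[2]<π[2] , _ = ⊥-elim (<-irrefl refl π[2]<π[2])
  ...     | suc (suc (suc j)) , _ , j≤n , π[2]<π[j] , _ =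
    ⊥-elim (<-asym π[2]<π[j] (suffix-decreasing (≤-trans (≤-reflexive b≡) (s≤s z≤n)) (s≤s (s≤s (s≤s z≤n))) j≤n))

  1≤b∸1 : 1 ≤ b ∸ 1
  1≤b∸1 = <⇒≤∸1 2≤b

  b∸1<b : b ∸ 1 < b
  b∸1<b = ∸-monoʳ-< (s≤s z≤n) 1≤b

  b∸1-not-RLmax : ¬ RLmax (b ∸ 1)
  b∸1-not-RLmax r = proj₂ (proj₂ (proj₂ b-first)) (∈-range⁺ 1≤b∸1 (≤-trans (<⇒≤ b∸1<b) b≤n)) b∸1<b
                      (all⁻ (isRLmax π) (All.tabulate {xs = range (b ∸ 1) n} λ {j} j∈ → suffix-from-b∸1 j (∈-range⁻ j∈)))
    where
    suffix-from-b∸1 : ∀ j → b ∸ 1 ≤ j × j ≤ n → RLmax j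
    suffix-from-b∸1 j (b∸1≤j , j≤n) with m≤n⇒m<n∨m≡n b∸1≤j
    ... | inj₁ b∸1<j = suffix-RLmax (∸1<⇒≤ 1≤b b∸1<j) j≤n
    ... | inj₂ refl  = r

  a : ℕ
  a = phiA π

  RLmax-before-b⇒≤a : ∀ {i} → 1 ≤ i → i < b → RLmax i → i ≤ a
  RLmax-before-b⇒≤a 1≤i i<b r =
    maxL-upper (filterᵇ (isRLmax π) (range 1 (b ∸ 1))) (∈-filter⁺ (T? ∘ isRLmax π) (∈-range⁺ 1≤i (<⇒≤∸1 i<b)) r)

  a-RLmax : 1 ≤ a → a < b × RLmax a
  a-RLmax 1≤a with maxL-selective (filterᵇ (isRLmax π) (range 1 (b ∸ 1)))
  ... | inj₁ a≡0 = ⊥-elim (1+n≰n (subst (1 ≤_) a≡0 1≤a))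
  ... | inj₂ a∈ with ∈-filter⁻ (T? ∘ isRLmax π) {xs = range 1 (b ∸ 1)} a∈
  ...   | a∈range , r = ≤∸1⇒< 1≤b (proj₂ (∈-range⁻ a∈range)) , r

  a+1<b : suc a < b
  a+1<b with 0 <? a
  ... | no  a≯0 = subst (λ x → suc x < b) (sym (n≤0⇒n≡0 (≮⇒≥ a≯0))) 2≤b
  ... | yes 1≤a with a-RLmax 1≤a
  ...   | a<b , r = +-<-∸ 1 (≤∧≢⇒< (<⇒≤∸1 a<b) (λ a≡b∸1 → b∸1-not-RLmax (subst RLmax a≡b∸1 r)))

  a<b : a < b
  a<b = <-trans (n<1+n a) a+1<b

  middle-not-RLmax : ∀ {i} → a < i → i < b → ¬ RLmax i
  middle-not-RLmax a<i i<b r = <⇒≱ a<i (RLmax-before-b⇒≤a (≤-trans (s≤s z≤n) a<i) i<b r)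

  a-dominates : ∀ {j} → 1 ≤ a → a < j → j ≤ n → π[ j ] < π[ a ]
  a-dominates 1≤a = proj₂ (proj₂ (RLmax⁻ (proj₂ (a-RLmax 1≤a))))

  χ : ℕ
  χ = chi π

  middle : List ℕ
  middle = range (suc a) (b ∸ 1)

  middle-≤χ : ∀ {j} → a < j → j < b → π[ j ] ≤ χ
  middle-≤χ a<j j<b = maxL-upper (map π[_] middle) (∈-map⁺ π[_] (∈-range⁺ a<j (<⇒≤∸1 j<b)))

  χ-attained : ∃[ m ] a < m × m < b × π[ m ] ≡ χ
  χ-attained with maxL-selective (map π[_] middle)
  ... | inj₂ χ∈ with ∈-map⁻ π[_] χ∈
  ...   | m , m∈ , χ≡ = m , proj₁ (∈-range⁻ m∈) , ≤∸1⇒< 1≤b (proj₂ (∈-range⁻ m∈)) , sym χ≡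
  χ-attained | inj₁ χ≡0 =
    ⊥-elim (1+n≰n (subst (1 ≤_) χ≡0 (≤-trans (proj₁ (value-bounds 1≤b∸1 (≤-trans (<⇒≤ b∸1<b) b≤n)))
                                              (middle-≤χ (<⇒≤∸1 a+1<b) b∸1<b))))

  m : ℕ
  m = proj₁ χ-attained

  a<m : a < m
  a<m = proj₁ (proj₂ χ-attained)

  m<b : m < b
  m<b = proj₁ (proj₂ (proj₂ χ-attained))

  π[m]≡χ : π[ m ] ≡ χ
  π[m]≡χ = proj₂ (proj₂ (proj₂ χ-attained))

  1≤m : 1 ≤ m
  1≤m = ≤-trans (s≤s z≤n) a<m

  m≤n : m ≤ n
  m≤n = ≤-trans (<⇒≤ m<b) b≤n

  χ<π[b] : χ < π[ b ]
  χ<π[b] with ¬RLmax⇒ 1≤m m≤n (middle-not-RLmax a<m m<b)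
  ... | j , m<j , j≤n , π[m]<π[j] with j <? b
  ...   | yes j<b = ⊥-elim (<⇒≱ π[m]<π[j] (subst (π[ j ] ≤_) (sym π[m]≡χ) (middle-≤χ (<-trans a<m m<j) j<b)))
  ...   | no  j≮b = <-≤-trans (subst (_< π[ j ]) π[m]≡χ π[m]<π[j]) (suffix-nonincreasing ≤-refl (≮⇒≥ j≮b) j≤n)

  χ≤prefix : ∀ {p} → 1 ≤ p → p < a → χ ≤ π[ p ]
  χ≤prefix {p} 1≤p p<a = ≮⇒≥ λ π[p]<χ →
    avoids (contains-1423-at π 1≤p p<a a<m m<b b≤n (subst (π[ p ] <_) (sym π[m]≡χ) π[p]<χ)
                                (subst (_< π[ b ]) (sym π[m]≡χ) χ<π[b]) (a-dominates 1≤a (<-trans a<m m<b) b≤n))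
    where
    1≤a : 1 ≤ a
    1≤a = ≤-trans 1≤p (<⇒≤ p<a)

  prefix-above : ∀ {p j} → 1 ≤ p → p ≤ a → a < j → j ≤ n → π[ j ] ≤ χ → π[ j ] ≤ π[ p ]
  prefix-above 1≤p p≤a a<j j≤n π[j]≤χ with m≤n⇒m<n∨m≡n p≤a
  ... | inj₁ p<a  = ≤-trans π[j]≤χ (χ≤prefix 1≤p p<a)
  ... | inj₂ refl = <⇒≤ (a-dominates 1≤p a<j j≤n)

  ρ : ℕ
  ρ = rho π

  above-χ : ℕ → Bool
  above-χ i = isRLmax π i ∧ (χ <ᵇ π[ i ])

  above-χ-closed : ∀ {i j} → i ∈ range (suc b) n → j ∈ range (suc b) n → i ≤ j → T (above-χ j) → T (above-χ i)
  above-χ-closed {i} {j} i∈ j∈ i≤j qj =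
    Equivalence.from T-∧ (suffix-RLmax b≤i (proj₂ (∈-range⁻ i∈)) ,
      <⇒<ᵇ (<-≤-trans (<ᵇ⇒< χ π[ j ] (proj₂ (Equivalence.to T-∧ qj)))
                      (suffix-nonincreasing b≤i i≤j (proj₂ (∈-range⁻ j∈)))))
    where
    b≤i : b ≤ i
    b≤i = <⇒≤ (proj₁ (∈-range⁻ i∈))

  above-χ⇔ : ∀ {j} → b < j → j ≤ n → T (above-χ j) ⇔ j < suc b + ρ
  above-χ⇔ b<j j≤n = count-range above-χ (suc b) n above-χ-closed (∈-range⁺ b<j j≤n)

  b+ρ≤n : b + ρ ≤ n
  b+ρ≤n = begin
    b + ρ                          ≤⟨ +-monoʳ-≤ b (count≤length above-χ (range (suc b) n)) ⟩
    b + length (range (suc b) n)   ≡⟨ cong (b +_) (length-range (suc b) n) ⟩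
    b + (n ∸ b)                    ≡⟨ m+[n∸m]≡n b≤n ⟩
    n                              ∎
    where open ≤-Reasoning

  head-above-χ : ∀ {j} → b ≤ j → j ≤ b + ρ → χ < π[ j ]
  head-above-χ b≤j j≤b+ρ with m≤n⇒m<n∨m≡n b≤j
  ... | inj₂ refl = χ<π[b]
  ... | inj₁ b<j  =
    <ᵇ⇒< χ _ (proj₂ (Equivalence.to T-∧ (Equivalence.from (above-χ⇔ b<j (≤-trans j≤b+ρ b+ρ≤n)) (s≤s j≤b+ρ))))

  tail-below-χ : ∀ {j} → b + ρ < j → j ≤ n → π[ j ] < χ
  tail-below-χ {j} b+ρ<j j≤n = subst (π[ j ] <_) π[m]≡χ
    (π-≤∧≢⇒< 1≤j j≤n 1≤m m≤n (λ j≡m → <-asym m<b (subst (b <_) j≡m b<j))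
      (subst (π[ j ] ≤_) (sym π[m]≡χ) (≮⇒≥ λ χ<π[j] →
        <⇒≱ (Equivalence.to (above-χ⇔ b<j j≤n) (Equivalence.from T-∧ (suffix-RLmax (<⇒≤ b<j) j≤n , <⇒<ᵇ χ<π[j])))
            b+ρ<j)))
    where
    b<j : b < j
    b<j = ≤-<-trans (m≤m+n b ρ) b+ρ<j
    1≤j : 1 ≤ j
    1≤j = ≤-trans 1≤b (<⇒≤ b<j)

  -- pi1 π and pi2 π are, by definition, std (map π[_] L₁) and std (map π[_] L₂).
  L₁ L₂ : List ℕ
  L₁ = range 1 a ++ range b (b + ρ)
  L₂ = range (suc a) b ++ range (suc (b + ρ)) n

  outside-L₁ : ∀ {j} → 1 ≤ j → j ≤ n → j ∉ L₁ → a < j × π[ j ] ≤ χ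
  outside-L₁ {j} 1≤j j≤n j∉ with j ≤? a | j <? b | j ≤? b + ρ
  ... | yes j≤a | _       | _         = ⊥-elim (j∉ (∈-++⁺ˡ (∈-range⁺ 1≤j j≤a)))
  ... | no  j≰a | yes j<b | _         = ≰⇒> j≰a , middle-≤χ (≰⇒> j≰a) j<b
  ... | no  _   | no  j≮b | yes j≤b+ρ = ⊥-elim (j∉ (∈-++⁺ʳ (range 1 a) (∈-range⁺ (≮⇒≥ j≮b) j≤b+ρ)))
  ... | no  j≰a | no  _   | no  j≰b+ρ = ≰⇒> j≰a , <⇒≤ (tail-below-χ (≰⇒> j≰b+ρ) j≤n)

  outside-L₂ : ∀ {j} → 1 ≤ j → j ≤ n → j ∉ L₂ → j ≤ a ⊎ χ < π[ j ]
  outside-L₂ {j} 1≤j j≤n j∉ with j ≤? a | j ≤? b | j ≤? b + ρ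
  ... | yes j≤a | _       | _         = inj₁ j≤a
  ... | no  j≰a | yes j≤b | _         = ⊥-elim (j∉ (∈-++⁺ˡ (∈-range⁺ (≰⇒> j≰a) j≤b)))
  ... | no  _   | no  j≰b | yes j≤b+ρ = inj₂ (head-above-χ (<⇒≤ (≰⇒> j≰b)) j≤b+ρ)
  ... | no  _   | no  _   | no  j≰b+ρ = ⊥-elim (j∉ (∈-++⁺ʳ (range (suc a) b) (∈-range⁺ (≰⇒> j≰b+ρ) j≤n)))

  value-between-outside : ∀ {L u} → 1 ≤ u → suc u ≤ n → GaplessDescent π[_] L u (suc u) →
                          ∃[ j ] 1 ≤ j × j ≤ n × j ∉ L × π[ suc u ] < π[ j ] × π[ j ] < π[ u ]
  value-between-outside 1≤u u<n (descent , gapless) with descent-gap no-steps 1≤u u<n descent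
  ... | j , 1≤j , j≤n , lower , upper = j , 1≤j , j≤n , (λ j∈ → gapless j∈ lower upper) , lower , upper

  π⁽¹⁾-prefix-step : ∀ {u} → 1 ≤ u → suc u ≤ a → GaplessDescent π[_] L₁ u (suc u) → ⊥
  π⁽¹⁾-prefix-step 1≤u u<a gd
    with value-between-outside 1≤u (≤-trans u<a (≤-trans (<⇒≤ a<b) b≤n)) gd
  ... | j , 1≤j , j≤n , j∉ , lower , _ with outside-L₁ 1≤j j≤n j∉
  ...   | a<j , π[j]≤χ = <⇒≱ lower (prefix-above (s≤s z≤n) u<a a<j j≤n π[j]≤χ)

  π⁽¹⁾-head-step : ∀ {u} → b ≤ u → suc u ≤ b + ρ → GaplessDescent π[_] L₁ u (suc u) → ⊥
  π⁽¹⁾-head-step b≤u u<b+ρ gd with value-between-outside (≤-trans 1≤b b≤u) (≤-trans u<b+ρ b+ρ≤n) gd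
  ... | j , 1≤j , j≤n , j∉ , lower , _ =
    <⇒≱ (<-trans (head-above-χ (≤-trans b≤u (n≤1+n _)) u<b+ρ) lower) (proj₂ (outside-L₁ 1≤j j≤n j∉))

  π⁽²⁾-middle-step : ∀ {u} → a < u → suc u ≤ b → GaplessDescent π[_] L₂ u (suc u) → ⊥
  π⁽²⁾-middle-step a<u u<b gd with value-between-outside (≤-trans (s≤s z≤n) a<u) (≤-trans u<b b≤n) gd
  ... | j , 1≤j , j≤n , j∉ , _ , upper with outside-L₂ 1≤j j≤n j∉
  ...   | inj₁ j≤a   = <⇒≱ upper (prefix-above 1≤j j≤a a<u (≤-trans (<⇒≤ u<b) b≤n) (middle-≤χ a<u u<b))
  ...   | inj₂ χ<π[j] = <⇒≱ (<-trans χ<π[j] upper) (middle-≤χ a<u u<b)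

  π⁽²⁾-junction-step : suc (b + ρ) ≤ n → GaplessDescent π[_] L₂ b (suc (b + ρ)) → ⊥
  π⁽²⁾-junction-step b+ρ<n (_ , gapless) =
    gapless (∈-++⁺ˡ (∈-range⁺ a<m (<⇒≤ m<b)))
            (subst (π[ suc (b + ρ) ] <_) (sym π[m]≡χ) (tail-below-χ ≤-refl b+ρ<n))
            (subst (_< π[ b ]) (sym π[m]≡χ) χ<π[b])

  π⁽²⁾-tail-step : ∀ {u} → suc (b + ρ) ≤ u → suc u ≤ n → GaplessDescent π[_] L₂ u (suc u) → ⊥
  π⁽²⁾-tail-step {u} b+ρ<u u<n gd with value-between-outside (≤-trans (s≤s z≤n) b+ρ<u) u<n gd
  ... | j , 1≤j , j≤n , j∉ , _ , upper with outside-L₂ 1≤j j≤n j∉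
  ...   | inj₁ j≤a   = <⇒≱ upper (prefix-above 1≤j j≤a a<u (<⇒≤ u<n) (<⇒≤ (tail-below-χ b+ρ<u (<⇒≤ u<n))))
    where
    a<u : a < u
    a<u = <-trans a<b (≤-<-trans (m≤m+n b ρ) b+ρ<u)
  ...   | inj₂ χ<π[j] = <-asym (<-trans χ<π[j] upper) (tail-below-χ b+ρ<u (<⇒≤ u<n))

  π⁽¹⁾-consecutive : ∀ {i u v} → Consecutive 1 a b (b + ρ) i u v → GaplessDescent π[_] L₁ u v → i ≡ a
  π⁽¹⁾-consecutive (left 1≤u u<a)    gd = ⊥-elim (π⁽¹⁾-prefix-step 1≤u u<a gd)
  π⁽¹⁾-consecutive (junction i≡a _)  _  = i≡a
  π⁽¹⁾-consecutive (right b≤u u<b+ρ) gd = ⊥-elim (π⁽¹⁾-head-step b≤u u<b+ρ gd)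

  π⁽²⁾-consecutive : ∀ {i u v} → Consecutive (suc a) b (suc (b + ρ)) n i u v → GaplessDescent π[_] L₂ u v → ⊥
  π⁽²⁾-consecutive (left a<u u<b)         gd = π⁽²⁾-middle-step a<u u<b gd
  π⁽²⁾-consecutive (junction _ b+ρ<n)     gd = π⁽²⁾-junction-step b+ρ<n gd
  π⁽²⁾-consecutive (right b+ρ<u u<n)      gd = π⁽²⁾-tail-step b+ρ<u u<n gd

  π⁽¹⁾-steps : ∀ i → Stp (pi1 π) i → i ≡ a
  π⁽¹⁾-steps i st with std-map-step π[_] L₁ st
  ... | 1≤i , i<len , gd = π⁽¹⁾-consecutive (consecutive-ranges 1 a b (b + ρ) 1≤i i<len) gd

  π⁽²⁾-steps : ∀ i → ¬ Stp (pi2 π) i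
  π⁽²⁾-steps i st with std-map-step π[_] L₂ st
  ... | 1≤i , i<len , gd = π⁽²⁾-consecutive (consecutive-ranges (suc a) b (suc (b + ρ)) n 1≤i i<len) gd

lemma4 : (n : ℕ) (π : List ℕ) → π ↭ range 1 n → Avoids π p1423 → π ≢ reverse (range 1 n)
         → (∀ i → ¬ Stp π i)
         → (∀ i → Stp (pi1 π) i → i ≡ phiA π) × (∀ i → ¬ Stp (pi2 π) i)
lemma4 n π π↭ avoids not-decreasing no-steps =
  Decomposition.π⁽¹⁾-steps π π↭′ avoids not-decreasing′ no-steps ,
  Decomposition.π⁽²⁾-steps π π↭′ avoids not-decreasing′ no-steps
  where
  |π|≡n : length π ≡ n
  |π|≡n = trans (↭-length π↭) (length-range 1 n)
  π↭′ : π ↭ range 1 (length π)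
  π↭′ = subst (λ k → π ↭ range 1 k) (sym |π|≡n) π↭
  not-decreasing′ : π ≢ reverse (range 1 (length π))
  not-decreasing′ = subst (λ k → π ≢ reverse (range 1 k)) (sym |π|≡n) not-decreasing
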